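{- Let $P\colon\mathcal{C}^{op}\to\mathbf{DLat}$ be a $\{\land,\lor\}$-doctrine with existential completion $P^\exists$ as described in the context. For all objects $c,d\in\mathcal{C}$, the map $\Sigma_d\colon P^\exists(d\times c)\to P^\exists(c)$ is left adjoint to ${\pi_d^\exists}^\ast\colon P^\exists(c)\to P^\exists(d\times c)$, where $\pi_d\colon d\times c\to c$ is the product projection.
   Context: A $\{\land,\lor\}$-doctrine is a functor $P\colon\mathcal{C}^{op}\to\mathbf{DLat}$ ($\mathcal{C}$ with finite products); $f^\ast=P(f)$; $\pi_d\colon d\times c\to c$ is the projection forgetting $d$. $P^\exists(c)$ is the posetal reflection of the preorder of finite sets $\{(d_1,x_1),\dots,(d_n,x_n)\}$ ($d_i\in\mathcal{C}$, $x_i\in P(d_i\times c)$) with $\{(d_i,x_i)\}_{i\le n}\le\{(e_j,y_j)\}_{j\le m}$ iff for each $i$ there are arrows $r_\ell\colon d_i\times c\to e_{j_\ell}\times c$ ($\ell=1,\dots,k$, $j_\ell\le m$) with $\pi_{e_{j_\ell}}\circ r_\ell=\pi_{d_i}$ and $x_i\le r_1^\ast y_{j_1}\lor\dots\lor r_k^\ast y_{j_k}$. For $f\colon c'\to c$, ${f^\exists}^\ast\colon P^\exists(c)\to P^\exists(c')$ sends $\{(d_i,x_i)\}$ to $\{(d_i,(1_{d_i}\times f)^\ast x_i)\}$. The map $\Sigma_d\colon P^\exists(d\times c)\to P^\exists(c)$ sends $\{(e_1,x_1),\dots,(e_n,x_n)\}$ (so $x_i\in P(e_i\times d\times c)$)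 to $\{(e_1\times d,x_1),\dots,(e_n\times d,x_n)\}$. -}

module Defs where

open import Level using (Level; _⊔_) renaming (suc to lsuc)
open import Data.Product using (Σ; _,_; proj₁; proj₂)
open import Data.List using (List; length; lookup; map)
open import Data.List.NonEmpty using (List⁺; foldr₁) renaming (map to map⁺)
open import Data.List.Relation.Unary.All using (All)
open import Data.Fin using (Fin)
open import Relation.Binary.PropositionalEquality using (_≡_)
open import Relation.Binary.Lattice.Bundles using (DistributiveLattice)

record Category (o h : Level) : Set (lsuc (o ⊔ h)) where
  infixr 9 _∘_
  infixr 5 _⇒_
  field
    Obj       : Set o
    _⇒_       : Obj → Obj → Set h
    id        : ∀ {a} → a ⇒ a
    _∘_       : ∀ {a b c} → b ⇒ c → a ⇒ b → a ⇒ c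
    identityˡ : ∀ {a b} {f : a ⇒ b} → id ∘ f ≡ f
    identityʳ : ∀ {a b} {f : a ⇒ b} → f ∘ id ≡ f
    assoc     : ∀ {a b c d} {f : a ⇒ b} {g : b ⇒ c} {k : c ⇒ d} →
                (k ∘ g) ∘ f ≡ k ∘ (g ∘ f)

record FiniteProducts {o h : Level} (C : Category o h) : Set (o ⊔ h) where
  open Category C
  infixr 7 _×_
  field
    ⊤        : Obj
    !        : ∀ {a} → a ⇒ ⊤
    !-unique : ∀ {a} (f : a ⇒ ⊤) → f ≡ !
    _×_      : Obj → Obj → Obj
    π₁       : ∀ {a b} → a × b ⇒ a
    π₂       : ∀ {a b} → a × b ⇒ b
    ⟨_,_⟩    : ∀ {x a b} → x ⇒ a → x ⇒ b → x ⇒ a × b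
    β₁       : ∀ {x a b} {f : x ⇒ a} {g : x ⇒ b} → π₁ ∘ ⟨ f , g ⟩ ≡ f
    β₂       : ∀ {x a b} {f : x ⇒ a} {g : x ⇒ b} → π₂ ∘ ⟨ f , g ⟩ ≡ g
    unique   : ∀ {x a b} {f : x ⇒ a} {g : x ⇒ b} {k : x ⇒ a × b} →
               π₁ ∘ k ≡ f → π₂ ∘ k ≡ g → k ≡ ⟨ f , g ⟩

  _⊗_ : ∀ {a b a' b'} → a ⇒ a' → b ⇒ b' → a × b ⇒ a' × b'
  f ⊗ g = ⟨ f ∘ π₁ , g ∘ π₂ ⟩

  assocˡ : ∀ {e d c} → (e × d) × c ⇒ e × (d × c)
  assocˡ = ⟨ π₁ ∘ π₁ , ⟨ π₂ ∘ π₁ , π₂ ⟩ ⟩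

∣_∣ : ∀ {a ℓ₁ ℓ₂} → DistributiveLattice a ℓ₁ ℓ₂ → Set a
∣ L ∣ = DistributiveLattice.Carrier L

record Doctrine {o h : Level} (C : Category o h) (a ℓ₁ ℓ₂ : Level)
       : Set (o ⊔ h ⊔ lsuc (a ⊔ ℓ₁ ⊔ ℓ₂)) where
  open Category C
  field
    P     : Obj → DistributiveLattice a ℓ₁ ℓ₂
  module PL (c : Obj) = DistributiveLattice (P c)
  field
    _*          : ∀ {c' c} → c' ⇒ c → ∣ P c ∣ → ∣ P c' ∣
    *-cong      : ∀ {c' c} (f : c' ⇒ c) {x y : ∣ P c ∣} →
                  PL._≈_ c x y → PL._≈_ c' ((f *) x) ((f *) y)
    *-∧         : ∀ {c' c} (f : c' ⇒ c) (x y : ∣ P c ∣) →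
                  PL._≈_ c' ((f *) (PL._∧_ c x y)) (PL._∧_ c' ((f *) x) ((f *) y))
    *-∨         : ∀ {c' c} (f : c' ⇒ c) (x y : ∣ P c ∣) →
                  PL._≈_ c' ((f *) (PL._∨_ c x y)) (PL._∨_ c' ((f *) x) ((f *) y))
    *-identity  : ∀ {c} (x : ∣ P c ∣) → PL._≈_ c ((id *) x) x
    *-homomorphism : ∀ {c'' c' c} (g : c'' ⇒ c') (f : c' ⇒ c) (x : ∣ P c ∣) →
                  PL._≈_ c'' (((f ∘ g) *) x) ((g *) ((f *) x))

-- The existential completion P^∃, presented as a preorder on finite
-- families {(d₁,x₁),…,(dₙ,xₙ)}; P^∃(c) is its posetal reflection.
module Existential {o h a ℓ₁ ℓ₂ : Level} {C : Category o h}
                   (FP : FiniteProducts C) (D : Doctrine C a ℓ₁ ℓ₂) where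
  open Category C
  open FiniteProducts FP
  open Doctrine D

  Elem : Obj → Set (o ⊔ a)
  Elem c = Σ Obj (λ d → ∣ P (d × c) ∣)

  P∃ : Obj → Set (o ⊔ a)
  P∃ c = List (Elem c)

  -- one summand r_ℓ^* y_{j_ℓ}: an index j into the family and an arrow
  -- r : d × c → e_j × c over c
  record Cover {c : Obj} (d : Obj) (B : P∃ c) : Set (o ⊔ h ⊔ a) where
    constructor cover
    field
      j    : Fin (length B)
      r    : d × c ⇒ proj₁ (lookup B j) × c
      over : π₂ ∘ r ≡ π₂

  pullCover : ∀ {c d} {B : P∃ c} → Cover d B → ∣ P (d × c) ∣
  pullCover {B = B} (cover j r _) = (r *) (proj₂ (lookup B j))

  ⋁⁺ : ∀ {c} → List⁺ ∣ P c ∣ → ∣ P c ∣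
  ⋁⁺ {c} = foldr₁ (PL._∨_ c)

  _◁_ : ∀ {c} → Elem c → P∃ c → Set (o ⊔ h ⊔ a ⊔ ℓ₂)
  _◁_ {c} (d , x) B =
    Σ (List⁺ (Cover d B)) λ rs → PL._≤_ (d × c) x (⋁⁺ (map⁺ pullCover rs))

  _≤∃_ : ∀ {c} → P∃ c → P∃ c → Set (o ⊔ h ⊔ a ⊔ ℓ₂)
  A ≤∃ B = All (λ e → e ◁ B) A

  reindex∃ : ∀ {c' c} → c' ⇒ c → P∃ c → P∃ c'
  reindex∃ f = map (λ { (d , x) → d , ((id ⊗ f) *) x })

  Σ∃ : ∀ (d : Obj) {c} → P∃ (d × c) → P∃ c
  Σ∃ d = map (λ { (e , x) → e × d , (assocˡ *) x })

{-# OPTIONS --safe #-}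
module Submission where

-- A cover of (e × d, x) by Y over c and a cover of (e, x) by (π₂^∃)* Y over
-- d × c carry the same data up to the associator (e × d) × c ≅ e × (d × c):
-- a summand r : (e × d) × c → eⱼ × c over c gives ⟨ π₁ ∘ r ∘ assocʳ , π₂ ⟩
-- over d × c, whose pullback of (id × π₂)* y is assocʳ* (r* y); conversely
-- r' over d × c gives (id × π₂) ∘ r' ∘ assocˡ over c.  Reindexing preserves
-- finite joins, so each covering join transports summand by summand.

open import Defs
open import Level using (Level; _⊔_)
open import Data.Product using (Σ-syntax; _×_; _,_; proj₁; proj₂)
open import Data.List using ([]; _∷_; map)
open import Data.List.NonEmpty using (List⁺; _∷_) renaming (map to map⁺)
open import Data.List.NonEmpty.Properties using () renaming (map-∘ to map⁺-∘)
import Data.List.Relation.Unary.All as All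
import Data.List.Relation.Unary.All.Properties as All
open import Data.List.Relation.Binary.Pointwise using (Pointwise; []; _∷_)
open import Data.Fin using (zero; suc)
open import Relation.Binary.Core using (REL)
open import Relation.Binary.PropositionalEquality as ≡ using (_≡_; refl; cong)
import Relation.Binary.Lattice.Properties.JoinSemilattice as JoinSemilatticeProperties
import Relation.Binary.Reasoning.PartialOrder as PosetReasoning
import Relation.Binary.Reasoning.Setoid as SetoidReasoning

module _ {a b r : Level} {A : Set a} {B : Set b} {f : A → B} where

  Pointwise-mapʳ : {R : REL A B r} → (∀ x → R x (f x)) → ∀ xs → Pointwise R xs (map f xs)
  Pointwise-mapʳ R-graph []       = []
  Pointwise-mapʳ R-graph (x ∷ xs) = R-graph x ∷ Pointwise-mapʳ R-graph xs

  Pointwise-mapˡ : {R : REL B A r} → (∀ x → R (f x) x) → ∀ xs → Pointwise R (map f xs) xs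
  Pointwise-mapˡ R-graph []       = []
  Pointwise-mapˡ R-graph (x ∷ xs) = R-graph x ∷ Pointwise-mapˡ R-graph xs

module Products {o h : Level} {C : Category o h} (FP : FiniteProducts C) where
  open Category C
  open FiniteProducts FP renaming (_×_ to _×ᶜ_)
  open ≡.≡-Reasoning

  pullˡ : ∀ {w x y z} {f : y ⇒ z} {g : x ⇒ y} {h : x ⇒ z} {k : w ⇒ x} →
          f ∘ g ≡ h → f ∘ (g ∘ k) ≡ h ∘ k
  pullˡ {k = k} fg≡h = ≡.trans (≡.sym assoc) (cong (_∘ k) fg≡h)

  ×-ext : ∀ {x a b} {k k' : x ⇒ a ×ᶜ b} → π₁ ∘ k ≡ π₁ ∘ k' → π₂ ∘ k ≡ π₂ ∘ k' → k ≡ k'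
  ×-ext p q = ≡.trans (unique p q) (≡.sym (unique refl refl))

  assocʳ : ∀ {e d c} → e ×ᶜ (d ×ᶜ c) ⇒ (e ×ᶜ d) ×ᶜ c
  assocʳ = ⟨ ⟨ π₁ , π₁ ∘ π₂ ⟩ , π₂ ∘ π₂ ⟩

  assocˡ∘assocʳ≡id : ∀ {e d c} → assocˡ {e} {d} {c} ∘ assocʳ ≡ id
  assocˡ∘assocʳ≡id = ×-ext first (×-ext middle last)
    where
    first : π₁ ∘ (assocˡ ∘ assocʳ) ≡ π₁ ∘ id
    first = begin
      π₁ ∘ (assocˡ ∘ assocʳ) ≡⟨ pullˡ β₁ ⟩
      (π₁ ∘ π₁) ∘ assocʳ     ≡⟨ assoc ⟩
      π₁ ∘ (π₁ ∘ assocʳ)     ≡⟨ cong (π₁ ∘_) β₁ ⟩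
      π₁ ∘ ⟨ π₁ , π₁ ∘ π₂ ⟩  ≡⟨ β₁ ⟩
      π₁                     ≡⟨ identityʳ ⟨
      π₁ ∘ id                ∎
    middle : π₁ ∘ (π₂ ∘ (assocˡ ∘ assocʳ)) ≡ π₁ ∘ (π₂ ∘ id)
    middle = begin
      π₁ ∘ (π₂ ∘ (assocˡ ∘ assocʳ)) ≡⟨ cong (π₁ ∘_) (pullˡ β₂) ⟩
      π₁ ∘ (⟨ π₂ ∘ π₁ , π₂ ⟩ ∘ assocʳ) ≡⟨ pullˡ β₁ ⟩
      (π₂ ∘ π₁) ∘ assocʳ               ≡⟨ assoc ⟩
      π₂ ∘ (π₁ ∘ assocʳ)               ≡⟨ cong (π₂ ∘_) β₁ ⟩
      π₂ ∘ ⟨ π₁ , π₁ ∘ π₂ ⟩            ≡⟨ β₂ ⟩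
      π₁ ∘ π₂                          ≡⟨ cong (π₁ ∘_) identityʳ ⟨
      π₁ ∘ (π₂ ∘ id)                   ∎
    last : π₂ ∘ (π₂ ∘ (assocˡ ∘ assocʳ)) ≡ π₂ ∘ (π₂ ∘ id)
    last = begin
      π₂ ∘ (π₂ ∘ (assocˡ ∘ assocʳ)) ≡⟨ cong (π₂ ∘_) (pullˡ β₂) ⟩
      π₂ ∘ (⟨ π₂ ∘ π₁ , π₂ ⟩ ∘ assocʳ) ≡⟨ pullˡ β₂ ⟩
      π₂ ∘ assocʳ                      ≡⟨ β₂ ⟩
      π₂ ∘ π₂                          ≡⟨ cong (π₂ ∘_) identityʳ ⟨
      π₂ ∘ (π₂ ∘ id)                   ∎

  ⊗-factor : ∀ {x y b b'} {h : b' ⇒ b} {s : x ×ᶜ b' ⇒ y ×ᶜ b} →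
             π₂ ∘ s ≡ h ∘ π₂ → (id ⊗ h) ∘ ⟨ π₁ ∘ s , π₂ ⟩ ≡ s
  ⊗-factor {h = h} {s} over-h = ×-ext first second
    where
    first : π₁ ∘ ((id ⊗ h) ∘ ⟨ π₁ ∘ s , π₂ ⟩) ≡ π₁ ∘ s
    first = begin
      π₁ ∘ ((id ⊗ h) ∘ ⟨ π₁ ∘ s , π₂ ⟩) ≡⟨ pullˡ β₁ ⟩
      (id ∘ π₁) ∘ ⟨ π₁ ∘ s , π₂ ⟩       ≡⟨ cong (_∘ ⟨ π₁ ∘ s , π₂ ⟩) identityˡ ⟩
      π₁ ∘ ⟨ π₁ ∘ s , π₂ ⟩              ≡⟨ β₁ ⟩
      π₁ ∘ s                            ∎
    second : π₂ ∘ ((id ⊗ h) ∘ ⟨ π₁ ∘ s , π₂ ⟩) ≡ π₂ ∘ s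
    second = begin
      π₂ ∘ ((id ⊗ h) ∘ ⟨ π₁ ∘ s , π₂ ⟩) ≡⟨ pullˡ β₂ ⟩
      (h ∘ π₂) ∘ ⟨ π₁ ∘ s , π₂ ⟩        ≡⟨ assoc ⟩
      h ∘ (π₂ ∘ ⟨ π₁ ∘ s , π₂ ⟩)        ≡⟨ cong (h ∘_) β₂ ⟩
      h ∘ π₂                            ≡⟨ over-h ⟨
      π₂ ∘ s                            ∎

  over-reassocˡ : ∀ {e d c e'} {r' : e ×ᶜ (d ×ᶜ c) ⇒ e' ×ᶜ (d ×ᶜ c)} →
                  π₂ ∘ r' ≡ π₂ → π₂ ∘ ((id ⊗ π₂) ∘ (r' ∘ assocˡ)) ≡ π₂
  over-reassocˡ {r' = r'} over' = begin
    π₂ ∘ ((id ⊗ π₂) ∘ (r' ∘ assocˡ)) ≡⟨ pullˡ β₂ ⟩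
    (π₂ ∘ π₂) ∘ (r' ∘ assocˡ)        ≡⟨ assoc ⟩
    π₂ ∘ (π₂ ∘ (r' ∘ assocˡ))        ≡⟨ cong (π₂ ∘_) (pullˡ over') ⟩
    π₂ ∘ (π₂ ∘ assocˡ)               ≡⟨ cong (π₂ ∘_) β₂ ⟩
    π₂ ∘ ⟨ π₂ ∘ π₁ , π₂ ⟩            ≡⟨ β₂ ⟩
    π₂                               ∎

module Completion {o h a ℓ₁ ℓ₂ : Level} {C : Category o h}
    (FP : FiniteProducts C) (D : Doctrine C a ℓ₁ ℓ₂) where
  open Category C
  open FiniteProducts FP renaming (_×_ to _×ᶜ_)
  open Doctrine D
  open Existential FP D
  open Products FP

  ≈-syntax : (c : Obj) → ∣ P c ∣ → ∣ P c ∣ → Set ℓ₁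
  ≈-syntax = PL._≈_
  syntax ≈-syntax c x y = x ≈[ c ] y

  ≤-syntax : (c : Obj) → ∣ P c ∣ → ∣ P c ∣ → Set ℓ₂
  ≤-syntax = PL._≤_
  syntax ≤-syntax c x y = x ≤[ c ] y

  *-≡ : ∀ {c' c} {f g : c' ⇒ c} (x : ∣ P c ∣) → f ≡ g → (f *) x ≈[ c' ] (g *) x
  *-≡ {c'} x refl = PL.Eq.refl c'

  *-retract : ∀ {a b} {f : b ⇒ a} {g : a ⇒ b} → f ∘ g ≡ id →
              (x : ∣ P a ∣) → x ≈[ a ] (g *) ((f *) x)
  *-retract {a} {f = f} {g} f∘g≡id x = begin
    x                ≈⟨ *-identity x ⟨
    (id *) x         ≈⟨ *-≡ x f∘g≡id ⟨
    ((f ∘ g) *) x    ≈⟨ *-homomorphism g f x ⟩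
    (g *) ((f *) x)  ∎
    where open SetoidReasoning (PL.setoid a)

  *-mono : ∀ {c' c} (f : c' ⇒ c) {x y : ∣ P c ∣} → x ≤[ c ] y → (f *) x ≤[ c' ] (f *) y
  *-mono {c'} {c} f {x} {y} x≤y = begin
    (f *) x                       ≤⟨ PL.x≤x∨y c' ((f *) x) ((f *) y) ⟩
    PL._∨_ c' ((f *) x) ((f *) y) ≈⟨ *-∨ f x y ⟨
    (f *) (PL._∨_ c x y)          ≈⟨ *-cong f (x≤y⇒x∨y≈y x≤y) ⟩
    (f *) y                       ∎
    where
    open PosetReasoning (PL.poset c')
    open JoinSemilatticeProperties (PL.joinSemilattice c) using (x≤y⇒x∨y≈y)

  *-⋁⁺ : ∀ {c' c} (f : c' ⇒ c) (xs : List⁺ ∣ P c ∣) →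
         (f *) (⋁⁺ xs) ≈[ c' ] ⋁⁺ (map⁺ (f *) xs)
  *-⋁⁺ {c'} f (x ∷ xs) = go x xs
    where
    open JoinSemilatticeProperties (PL.joinSemilattice c') using (∨-cong)
    go : ∀ x xs → (f *) (⋁⁺ (x ∷ xs)) ≈[ c' ] ⋁⁺ (map⁺ (f *) (x ∷ xs))
    go x []       = PL.Eq.refl c'
    go x (y ∷ ys) = PL.Eq.trans c' (*-∨ f x (⋁⁺ (y ∷ ys))) (∨-cong (PL.Eq.refl c') (go y ys))

  ⋁⁺-map-cong : ∀ {c ℓ} {A : Set ℓ} {u v : A → ∣ P c ∣} → (∀ x → u x ≈[ c ] v x) →
                (xs : List⁺ A) → ⋁⁺ (map⁺ u xs) ≈[ c ] ⋁⁺ (map⁺ v xs)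
  ⋁⁺-map-cong {c} {u = u} {v} u≈v (x ∷ xs) = go x xs
    where
    open JoinSemilatticeProperties (PL.joinSemilattice c) using (∨-cong)
    go : ∀ x xs → ⋁⁺ (map⁺ u (x ∷ xs)) ≈[ c ] ⋁⁺ (map⁺ v (x ∷ xs))
    go x []       = u≈v x
    go x (y ∷ ys) = ∨-cong (u≈v x) (go y ys)

  LiftsAlong : ∀ {c c' d d'} → d' ×ᶜ c' ⇒ d ×ᶜ c → Elem c → Elem c' → Set (h ⊔ ℓ₁)
  LiftsAlong {c} {c'} {d} {d'} g (e , y) (e' , y') =
    (r : d ×ᶜ c ⇒ e ×ᶜ c) → π₂ ∘ r ≡ π₂ →
    Σ[ r' ∈ d' ×ᶜ c' ⇒ e' ×ᶜ c' ] (π₂ ∘ r' ≡ π₂) × ((r' *) y' ≈[ d' ×ᶜ c' ] (g *) ((r *) y))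

  lift-Cover : ∀ {c c' d d'} {g : d' ×ᶜ c' ⇒ d ×ᶜ c} {B : P∃ c} {B' : P∃ c'} →
               Pointwise (LiftsAlong g) B B' → (k : Cover d B) →
               Σ[ k' ∈ Cover d' B' ] pullCover k' ≈[ d' ×ᶜ c' ] (g *) (pullCover k)
  lift-Cover (lift ∷ _) (cover zero r over) =
    let r' , over' , pull≈ = lift r over in cover zero r' over' , pull≈
  lift-Cover (_ ∷ lifts) (cover (suc j) r over) =
    let cover j' r' over' , pull≈ = lift-Cover lifts (cover j r over)
    in cover (suc j') r' over' , pull≈

  ◁-transport : ∀ {c c' d d'} {g : d' ×ᶜ c' ⇒ d ×ᶜ c} {B : P∃ c} {B' : P∃ c'} {x x'} →
                Pointwise (LiftsAlong g) B B' → x' ≤[ d' ×ᶜ c' ] (g *) x →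
                (d , x) ◁ B → (d' , x') ◁ B'
  ◁-transport {c' = c'} {d} {d'} {g} {B} {B'} {x} {x'} lifts x'≤gx (ks , x≤⋁) =
    map⁺ lift ks , (begin
      x'                                        ≤⟨ x'≤gx ⟩
      (g *) x                                   ≤⟨ *-mono g x≤⋁ ⟩
      (g *) (⋁⁺ (map⁺ pullCover ks))            ≈⟨ *-⋁⁺ g (map⁺ pullCover ks) ⟩
      ⋁⁺ (map⁺ (g *) (map⁺ pullCover ks))       ≡⟨ cong ⋁⁺ (map⁺-∘ ks) ⟨
      ⋁⁺ (map⁺ (λ k → (g *) (pullCover k)) ks)  ≈⟨ ⋁⁺-map-cong pullCover-lift ks ⟨
      ⋁⁺ (map⁺ (λ k → pullCover (lift k)) ks)   ≡⟨ cong ⋁⁺ (map⁺-∘ ks) ⟩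
      ⋁⁺ (map⁺ pullCover (map⁺ lift ks))        ∎)
    where
    open PosetReasoning (PL.poset (d' ×ᶜ c'))
    lift : Cover d B → Cover d' B'
    lift k = proj₁ (lift-Cover lifts k)
    pullCover-lift : ∀ k → pullCover (lift k) ≈[ d' ×ᶜ c' ] (g *) (pullCover k)
    pullCover-lift k = proj₂ (lift-Cover lifts k)

  lift-into-reindex : ∀ {c d e} (b : Elem c) →
                      LiftsAlong (assocʳ {e} {d} {c}) b (proj₁ b , ((id ⊗ π₂) *) (proj₂ b))
  lift-into-reindex {c} {d} {e} (eⱼ , y) r over = r' , β₂ , (begin
      (r' *) (((id ⊗ π₂) *) y) ≈⟨ *-homomorphism r' (id ⊗ π₂) y ⟨
      (((id ⊗ π₂) ∘ r') *) y   ≈⟨ *-≡ y (⊗-factor (≡.trans (pullˡ over) β₂)) ⟩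
      ((r ∘ assocʳ) *) y       ≈⟨ *-homomorphism assocʳ r y ⟩
      (assocʳ *) ((r *) y)     ∎)
    where
    open SetoidReasoning (PL.setoid (e ×ᶜ (d ×ᶜ c)))
    r' : e ×ᶜ (d ×ᶜ c) ⇒ eⱼ ×ᶜ (d ×ᶜ c)
    r' = ⟨ π₁ ∘ (r ∘ assocʳ) , π₂ ⟩

  lift-out-of-reindex : ∀ {c d e} (b : Elem c) →
                        LiftsAlong (assocˡ {e} {d} {c}) (proj₁ b , ((id ⊗ π₂) *) (proj₂ b)) b
  lift-out-of-reindex {c} {d} {e} (eⱼ , y) r' over' = r , over-reassocˡ over' , (begin
      (r *) y                                ≈⟨ *-homomorphism (r' ∘ assocˡ) (id ⊗ π₂) y ⟩
      ((r' ∘ assocˡ) *) (((id ⊗ π₂) *) y)    ≈⟨ *-homomorphism assocˡ r' _ ⟩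
      (assocˡ *) ((r' *) (((id ⊗ π₂) *) y))  ∎)
    where
    open SetoidReasoning (PL.setoid ((e ×ᶜ d) ×ᶜ c))
    r : (e ×ᶜ d) ×ᶜ c ⇒ eⱼ ×ᶜ c
    r = (id ⊗ π₂) ∘ (r' ∘ assocˡ)

  Σ∃-≤∃⇒≤∃-reindex∃ : ∀ {c d} (X : P∃ (d ×ᶜ c)) (Y : P∃ c) →
                      Σ∃ d X ≤∃ Y → X ≤∃ reindex∃ π₂ Y
  Σ∃-≤∃⇒≤∃-reindex∃ X Y ΣX≤Y =
    All.map (λ { {e , x} → ◁-transport (Pointwise-mapʳ lift-into-reindex Y)
                                       (PL.reflexive _ (*-retract assocˡ∘assocʳ≡id x)) })
            (All.map⁻ ΣX≤Y)

  ≤∃-reindex∃⇒Σ∃-≤∃ : ∀ {c d} (X : P∃ (d ×ᶜ c)) (Y : P∃ c) →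
                      X ≤∃ reindex∃ π₂ Y → Σ∃ d X ≤∃ Y
  ≤∃-reindex∃⇒Σ∃-≤∃ X Y X≤π₂Y =
    All.map⁺ (All.map (◁-transport (Pointwise-mapˡ lift-out-of-reindex Y) (PL.refl _)) X≤π₂Y)

lemma4p3 : ∀ {o h a ℓ₁ ℓ₂ : Level} {C : Category o h}
             (FP : FiniteProducts C) (D : Doctrine C a ℓ₁ ℓ₂) →
           let open Category C
               open FiniteProducts FP renaming (_×_ to _×ᶜ_)
               open Existential FP D
           in ∀ (c d : Obj) (X : P∃ (d ×ᶜ c)) (Y : P∃ c) →
                ((Σ∃ d X ≤∃ Y → X ≤∃ reindex∃ (π₂ {d} {c}) Y)
                 × (X ≤∃ reindex∃ (π₂ {d} {c}) Y → Σ∃ d X ≤∃ Y))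
lemma4p3 FP D c d X Y =
  Σ∃-≤∃⇒≤∃-reindex∃ X Y , ≤∃-reindex∃⇒Σ∃-≤∃ X Y
  where open Completion FP D
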